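{- Let $T_p$ and $T_d$ be binary search trees (of any of the four balancing schemes: AVL, red-black, weight-balanced, treap) and consider the execution of $\mathrm{union}$, $\mathrm{intersect}$ or $\mathrm{difference}$ (algorithms in the context) with decomposed tree $T_d$ and pivot tree $T_p$. For any disjoint set $V\subseteq T_p$, $\sum_{v\in V}|T_d(v)|\le|T_d|$.
   Context: A binary tree is either $\mathrm{Leaf}$ or $\mathrm{Node}(L,k,R)$; $\mathrm{expose}(\mathrm{Node}(L,k,R))=(L,k,R)$; $|T|$ denotes the number of keys (nodes). A BST has keys from a total order with strictly increasing in-order sequence. Ancestor is inclusive of the node itself. A set $V$ of nodes of a BST is a disjoint set if for any two distinct nodes $v_1,v_2\in V$, $v_1$ is not an ancestor of $v_2$. $\mathrm{split}(T,k)$ returns $(T_l,b,T_r)$ where $T_l$ (resp. $T_r$) is a balanced BST containing exactly the keys of $T$ less (resp. greater) than $k$ and $b$ indicates whether $k\in T$. $\mathrm{union}(T_1,T_2)$: if $T_1=\mathrm{Leaf}$ return $T_2$; if $T_2=\mathrm{Leaf}$ return $T_1$; $(L_2,k_2,R_2)=\mathrm{expose}(T_2)$; $(L_1,b,R_1)=\mathrm{split}(T_1,k_2)$; in parallel $T_l=\mathrm{union}(L_1,L_2)$ and $T_r=\mathrm{union}(R_1,R_2)$; return $\mathrm{join}(T_l,k_2,T_r)$ (join combines into a balanced BST on $T_l\cup\{k_2\}\cup T_r$). $\mathrm{intersect}$ and $\mathrm{difference}$ have the same base structure of splitting $T_1$ by $k(T_2)$ and recursing in parallel on $(L_1,L_2)$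 and $(R_1,R_2)$ (intersect returns Leaf if either argument is Leaf; difference returns Leaf if $T_1$ is Leaf and $T_1$ if $T_2$ is Leaf), differing only in how results are combined. The first argument is the decomposed tree, the second the pivot tree. For a node $v$ of the top-level pivot tree $T_p$, let $T_p(v)$ be the subtree of $T_p$ rooted at $v$, and $T_d(v)$ the first argument of the recursive call whose second argument is $T_p(v)$ (the tree that $v$ splits); if no such call occurs, $T_d(v)$ is empty. -}

module Defs where

open import Level using (Level; _⊔_)
open import Data.Nat using (ℕ; zero; suc; _+_; _≤_)
open import Data.Bool using (Bool; true)
open import Data.Product using (_×_; _,_; proj₁; proj₂)
open import Data.List using (List; []; _∷_; _++_)
open import Data.List.Relation.Unary.Linked using (Linked)
open import Data.List.Relation.Unary.All using (All)
open import Data.List.Relation.Unary.AllPairs using (AllPairs)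
open import Relation.Nullary using (¬_)
open import Relation.Binary.PropositionalEquality using (_≡_)
open import Relation.Binary.Bundles using (StrictTotalOrder)
open import Function.Bundles using (_⇔_)

data Tree {a} (K : Set a) : Set a where
  leaf : Tree K
  node : Tree K → K → Tree K → Tree K

-- Positions (nodes) of a tree, addressed by root-to-node paths.
data Dir : Set where
  goL goR : Dir

Path : Set
Path = List Dir

data Ancestor : Path → Path → Set where
  self  : ∀ {q} → Ancestor [] q
  step  : ∀ {d p q} → Ancestor p q → Ancestor (d ∷ p) (d ∷ q)

module _ {a} {K : Set a} where

  size : Tree K → ℕ
  size leaf         = 0
  size (node l _ r) = size l + suc (size r)

  inorder : Tree K → List K
  inorder leaf         = []
  inorder (node l k r) = inorder l ++ (k ∷ inorder r)

  data IsNode : Tree K → Path → Set a where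
    here  : ∀ {l k r}   → IsNode (node l k r) []
    inL   : ∀ {l k r p} → IsNode l p → IsNode (node l k r) (goL ∷ p)
    inR   : ∀ {l k r p} → IsNode r p → IsNode (node l k r) (goR ∷ p)

  -- A disjoint set of nodes of T, given as a list of paths: every element is
  -- a node of T and for any two entries (at distinct list positions) neither
  -- is an ancestor of the other (this in particular forbids duplicates).
  DisjointSet : Tree K → List Path → Set a
  DisjointSet T V =
    All (IsNode T) V ×
    AllPairs (λ p q → ¬ Ancestor p q × ¬ Ancestor q p) V

module _ {a ℓ₁ ℓ₂} (O : StrictTotalOrder a ℓ₁ ℓ₂) where
  open StrictTotalOrder O renaming (Carrier to K)

  data _∈T_ (x : K) : Tree K → Set (a ⊔ ℓ₁) where
    here  : ∀ {l k r} → x ≈ k → x ∈T node l k r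
    inL   : ∀ {l k r} → x ∈T l → x ∈T node l k r
    inR   : ∀ {l k r} → x ∈T r → x ∈T node l k r

  IsBST : Tree K → Set (a ⊔ ℓ₂)
  IsBST T = Linked _<_ (inorder T)

  -- Specification of split(T,k) = (T_l, b, T_r) relative to a balancing
  -- scheme, given as a predicate Balanced on trees.
  SplitSpec : ∀ {β} (Balanced : Tree K → Set β) →
              (Tree K → K → Tree K × Bool × Tree K) → Set (a ⊔ ℓ₁ ⊔ ℓ₂ ⊔ β)
  SplitSpec Balanced split =
    ∀ T k → IsBST T → Balanced T →
      let Tl = proj₁ (split T k)
          b  = proj₁ (proj₂ (split T k))
          Tr = proj₂ (proj₂ (split T k))
      in IsBST Tl × Balanced Tl × IsBST Tr × Balanced Tr ×
         (∀ x → (x ∈T Tl) ⇔ (x ∈T T × x < k)) ×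
         (∀ x → (x ∈T Tr) ⇔ (x ∈T T × k < x)) ×
         ((b ≡ true) ⇔ (k ∈T T))

  -- T_d(v) for the execution of union / intersect / difference(T_d, T_p):
  -- all three algorithms make exactly the same recursive calls
  -- (stop if either argument is Leaf; otherwise split T1 by the root key
  -- of T2 and recurse on (L1,L2) and (R1,R2)).
  -- decomposed T1 pivot T2 v = first argument of the call whose second
  -- argument is the subtree of T2 at path v (Leaf if there is no such call).
  decomposed : (Tree K → K → Tree K × Bool × Tree K) →
               Tree K → Tree K → Path → Tree K
  decomposed split T1 T2 [] = T1
  decomposed split leaf T2 (_ ∷ _) = leaf
  decomposed split (node _ _ _) leaf (_ ∷ _) = leaf
  decomposed split T1@(node _ _ _) (node L2 k2 R2) (goL ∷ p) =
    decomposed split (proj₁ (split T1 k2)) L2 p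
  decomposed split T1@(node _ _ _) (node L2 k2 R2) (goR ∷ p) =
    decomposed split (proj₂ (proj₂ (split T1 k2))) R2 p

-- The recursion of union/intersect/difference sends the decomposed tree of a
-- pivot node v to the two halves produced by splitting it at the key of v,
-- and two halves of a split hold at most as many keys as the tree split.
-- Hence, by induction on the pivot tree, the decomposed trees of the nodes of
-- a disjoint set inside T_p(v) have at most |T_d(v)| keys in total: if v
-- itself belongs to the set it is the only member, and otherwise the set
-- falls apart into disjoint sets of the two subtrees of v.
module Submission where

open import Defs
open import Level using (Level)
open import Level using (_⊔_)
open import Data.Nat using (ℕ; _≤_)
open import Data.Bool using (Bool)
open import Data.Product using (_×_)
open import Data.List using (List; map)
open import Data.Nat.ListAction using (sum)
open import Relation.Binary.Bundles using (StrictTotalOrder)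

open import Data.Nat using (suc; _+_; z≤n)
open import Data.Nat.Properties using (+-mono-≤; +-identityʳ; ≤-reflexive; +-assoc; +-commutativeSemigroup; module ≤-Reasoning)
open import Algebra.Properties.CommutativeSemigroup +-commutativeSemigroup using (x∙yz≈y∙xz)
open import Data.Product using (_,_; proj₁; proj₂)
open import Data.Sum using (_⊎_; inj₁; inj₂)
open import Data.List using ([]; _∷_; _++_; [_]; length)
open import Data.List.Properties using (length-++)
open import Data.List.Relation.Unary.All as All using (All; []; _∷_)
open import Data.List.Relation.Unary.Any using (here; there)
import Data.List.Relation.Unary.Any.Properties as Any
open import Data.List.Relation.Unary.AllPairs using (AllPairs; []; _∷_)
import Data.List.Relation.Unary.All.Properties as All
import Data.List.Relation.Unary.AllPairs.Properties as AllPairs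
open import Data.List.Relation.Unary.Linked.Properties using (Linked⇒AllPairs)
open import Data.List.Relation.Binary.Sublist.Heterogeneous using (Sublist; minimum; _∷_; _∷ʳ_)
open import Data.List.Relation.Binary.Sublist.Heterogeneous.Properties using (length-mono-≤)
open import Data.Empty using (⊥-elim)
open import Function using (_∘_)
open import Function.Bundles using (Equivalence)
open import Relation.Nullary using (¬_)
open import Relation.Binary.PropositionalEquality using (_≡_; refl; sym; trans; cong; cong₂; subst₂; module ≡-Reasoning)

Separated : Path → Path → Set
Separated p q = ¬ Ancestor p q × ¬ Ancestor q p

data NonRoot : Path → Set where
  nonRoot : ∀ {d p} → NonRoot (d ∷ p)

descend : Dir → List Path → List Path
descend d   []              = []
descend d   ([] ∷ V)        = descend d V
descend goL ((goL ∷ p) ∷ V) = p ∷ descend goL V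
descend goL ((goR ∷ p) ∷ V) = descend goL V
descend goR ((goL ∷ p) ∷ V) = descend goR V
descend goR ((goR ∷ p) ∷ V) = p ∷ descend goR V

root-or-nonRoot : ∀ {V} → AllPairs Separated V → V ≡ [ [] ] ⊎ All NonRoot V
root-or-nonRoot {[]}          _               = inj₂ []
root-or-nonRoot {[] ∷ []}     _               = inj₁ refl
root-or-nonRoot {[] ∷ _ ∷ _}  ((sep ∷ _) ∷ _) = ⊥-elim (proj₁ sep self)
root-or-nonRoot {(_ ∷ _) ∷ V} (seps ∷ sepss) with root-or-nonRoot sepss
... | inj₁ refl = ⊥-elim (proj₂ (All.head seps) self)
... | inj₂ nrs  = inj₂ (nonRoot ∷ nrs)

descend-Separated : ∀ d {p} V → All (Separated (d ∷ p)) V → All (Separated p) (descend d V)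
descend-Separated d   []              []           = []
descend-Separated d   ([] ∷ V)        (_ ∷ seps)   = descend-Separated d V seps
descend-Separated goL ((goL ∷ q) ∷ V) (sep ∷ seps) =
  ((proj₁ sep ∘ step) , (proj₂ sep ∘ step)) ∷ descend-Separated goL V seps
descend-Separated goL ((goR ∷ q) ∷ V) (_ ∷ seps)   = descend-Separated goL V seps
descend-Separated goR ((goL ∷ q) ∷ V) (_ ∷ seps)   = descend-Separated goR V seps
descend-Separated goR ((goR ∷ q) ∷ V) (sep ∷ seps) =
  ((proj₁ sep ∘ step) , (proj₂ sep ∘ step)) ∷ descend-Separated goR V seps

descend-AllPairs : ∀ d V → AllPairs Separated V → AllPairs Separated (descend d V)
descend-AllPairs d   []              []             = []
descend-AllPairs d   ([] ∷ V)        (_ ∷ sepss)    = descend-AllPairs d V sepss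
descend-AllPairs goL ((goL ∷ q) ∷ V) (seps ∷ sepss) = descend-Separated goL V seps ∷ descend-AllPairs goL V sepss
descend-AllPairs goL ((goR ∷ q) ∷ V) (_ ∷ sepss)    = descend-AllPairs goL V sepss
descend-AllPairs goR ((goL ∷ q) ∷ V) (_ ∷ sepss)    = descend-AllPairs goR V sepss
descend-AllPairs goR ((goR ∷ q) ∷ V) (seps ∷ sepss) = descend-Separated goR V seps ∷ descend-AllPairs goR V sepss

sum-descend : (f : Path → ℕ) → ∀ {V} → All NonRoot V →
  sum (map f V) ≡ sum (map (f ∘ (goL ∷_)) (descend goL V)) + sum (map (f ∘ (goR ∷_)) (descend goR V))
sum-descend f {[]}            []        = refl
sum-descend f {(goL ∷ p) ∷ V} (_ ∷ nrs) =
  trans (cong (f (goL ∷ p) +_) (sum-descend f nrs)) (sym (+-assoc (f (goL ∷ p)) _ _))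
sum-descend f {(goR ∷ p) ∷ V} (_ ∷ nrs) =
  trans (cong (f (goR ∷ p) +_) (sum-descend f nrs)) (x∙yz≈y∙xz (f (goR ∷ p)) (sum (map (f ∘ (goL ∷_)) (descend goL V))) _)

module _ {a} {K : Set a} where

  length-inorder : (T : Tree K) → length (inorder T) ≡ size T
  length-inorder leaf         = refl
  length-inorder (node l k r) = begin
    length (inorder l ++ k ∷ inorder r)         ≡⟨ length-++ (inorder l) ⟩
    length (inorder l) + length (k ∷ inorder r) ≡⟨ cong₂ (λ m n → m + suc n) (length-inorder l) (length-inorder r) ⟩
    size (node l k r)                           ∎
    where open ≡-Reasoning

  subtree : Dir → Tree K → Tree K
  subtree _   leaf         = leaf
  subtree goL (node l _ _) = l
  subtree goR (node _ _ r) = r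

  descend-IsNode : ∀ d {T : Tree K} V → All (IsNode T) V → All (IsNode (subtree d T)) (descend d V)
  descend-IsNode d   []              []               = []
  descend-IsNode d   ([] ∷ V)        (_ ∷ nodes)      = descend-IsNode d V nodes
  descend-IsNode goL ((goL ∷ q) ∷ V) (inL p∈ ∷ nodes) = p∈ ∷ descend-IsNode goL V nodes
  descend-IsNode goL ((goR ∷ q) ∷ V) (_ ∷ nodes)      = descend-IsNode goL V nodes
  descend-IsNode goR ((goL ∷ q) ∷ V) (_ ∷ nodes)      = descend-IsNode goR V nodes
  descend-IsNode goR ((goR ∷ q) ∷ V) (inR p∈ ∷ nodes) = p∈ ∷ descend-IsNode goR V nodes

  descend-DisjointSet : ∀ d {T : Tree K} {V} → DisjointSet T V → DisjointSet (subtree d T) (descend d V)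
  descend-DisjointSet d {V = V} (nodes , sepss) = descend-IsNode d V nodes , descend-AllPairs d V sepss

module _ {a ℓ₁ ℓ₂} (O : StrictTotalOrder a ℓ₁ ℓ₂) where
  open StrictTotalOrder O renaming (Carrier to K; trans to <-trans)
  open import Data.List.Membership.Setoid Eq.setoid using (_∈_)

  ∈-tail : ∀ {y z zs} → y < z → z ∈ y ∷ zs → z ∈ zs
  ∈-tail y<z (here z≈y) = ⊥-elim (irrefl (Eq.sym z≈y) y<z)
  ∈-tail _   (there z∈) = z∈

  sorted-⊆⇒Sublist : ∀ {xs ys} → AllPairs _<_ xs → AllPairs _<_ ys → All (_∈ ys) xs → Sublist _≈_ xs ys
  sorted-⊆⇒Sublist {[]}     _          _          _         = minimum _
  sorted-⊆⇒Sublist {_ ∷ _}  _          []         (() ∷ _)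
  sorted-⊆⇒Sublist {x ∷ xs} (x<xs ∷ xs<) (y<ys ∷ ys<) (here x≈y ∷ xs∈) =
    x≈y ∷ sorted-⊆⇒Sublist xs< ys< (All.zipWith (λ (x<z , z∈) → ∈-tail (<-respˡ-≈ x≈y x<z) z∈) (x<xs , xs∈))
  sorted-⊆⇒Sublist {x ∷ xs} (x<xs ∷ xs<) (y<ys ∷ ys<) (there x∈ys ∷ xs∈) =
    _ ∷ʳ sorted-⊆⇒Sublist (x<xs ∷ xs<) ys< (All.zipWith (λ (y<z , z∈) → ∈-tail y<z z∈) (y<x∷xs , there x∈ys ∷ xs∈))
    where
    y<x : _ < x
    y<x = All.lookupₛ Eq.setoid (<-respʳ-≈) y<ys x∈ys
    y<x∷xs : All (_ <_) (x ∷ xs)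
    y<x∷xs = y<x ∷ All.map (<-trans y<x) x<xs

  _∈ₜ_ : K → Tree K → Set (a ⊔ ℓ₁)
  _∈ₜ_ = _∈T_ O

  ∈ₜ⇒∈-inorder : ∀ {x} T → x ∈ₜ T → x ∈ inorder T
  ∈ₜ⇒∈-inorder (node l k r) (here x≈k) = Any.++⁺ʳ (inorder l) (here x≈k)
  ∈ₜ⇒∈-inorder (node l k r) (inL x∈l)  = Any.++⁺ˡ (∈ₜ⇒∈-inorder l x∈l)
  ∈ₜ⇒∈-inorder (node l k r) (inR x∈r)  = Any.++⁺ʳ (inorder l) (there (∈ₜ⇒∈-inorder r x∈r))

  inorder-∈ₜ : ∀ T → All (_∈ₜ T) (inorder T)
  inorder-∈ₜ leaf         = []
  inorder-∈ₜ (node l k r) = All.++⁺ (All.map inL (inorder-∈ₜ l)) (here Eq.refl ∷ All.map inR (inorder-∈ₜ r))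

  IsBST⇒sorted : ∀ T → IsBST O T → AllPairs _<_ (inorder T)
  IsBST⇒sorted _ = Linked⇒AllPairs <-trans

  size-+-≤ : ∀ {A B T} → IsBST O A → IsBST O B → IsBST O T →
             (∀ {x} → x ∈ₜ A → x ∈ₜ T) → (∀ {x} → x ∈ₜ B → x ∈ₜ T) →
             (∀ {x y} → x ∈ₜ A → y ∈ₜ B → x < y) →
             size A + size B ≤ size T
  size-+-≤ {A} {B} {T} bstA bstB bstT A⊆T B⊆T A<B =
    subst₂ _≤_ (begin
        length (inorder A ++ inorder B)         ≡⟨ length-++ (inorder A) ⟩
        length (inorder A) + length (inorder B) ≡⟨ cong₂ _+_ (length-inorder A) (length-inorder B) ⟩
        size A + size B                         ∎)
      (length-inorder T)
      (length-mono-≤ (sorted-⊆⇒Sublist AB-sorted (IsBST⇒sorted T bstT) AB⊆T))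
    where
    open ≡-Reasoning
    AB-sorted : AllPairs _<_ (inorder A ++ inorder B)
    AB-sorted = AllPairs.++⁺ (IsBST⇒sorted A bstA) (IsBST⇒sorted B bstB)
      (All.map (λ x∈A → All.map (A<B x∈A) (inorder-∈ₜ B)) (inorder-∈ₜ A))
    AB⊆T : All (_∈ inorder T) (inorder A ++ inorder B)
    AB⊆T = All.++⁺ (All.map (∈ₜ⇒∈-inorder T ∘ A⊆T) (inorder-∈ₜ A))
                   (All.map (∈ₜ⇒∈-inorder T ∘ B⊆T) (inorder-∈ₜ B))

  module _ {β} (Balanced : Tree K → Set β) (split : Tree K → K → Tree K × Bool × Tree K)
           (spec : SplitSpec O Balanced split) where

    split-size : ∀ {T} k → IsBST O T → Balanced T →
                 size (proj₁ (split T k)) + size (proj₂ (proj₂ (split T k))) ≤ size T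
    split-size {T} k bst bal with spec T k bst bal
    ... | bstˡ , _ , bstʳ , _ , ∈ˡ , ∈ʳ , _ =
      size-+-≤ bstˡ bstʳ bst (proj₁ ∘ to (∈ˡ _)) (proj₁ ∘ to (∈ʳ _))
        (λ x∈ˡ y∈ʳ → <-trans (proj₂ (to (∈ˡ _) x∈ˡ)) (proj₂ (to (∈ʳ _) y∈ʳ)))
      where open Equivalence

    sum-decomposed-leaf : ∀ Tp V → sum (map (size ∘ decomposed O split leaf Tp) V) ≡ 0
    sum-decomposed-leaf Tp []            = refl
    sum-decomposed-leaf Tp ([] ∷ V)      = sum-decomposed-leaf Tp V
    sum-decomposed-leaf Tp ((_ ∷ _) ∷ V) = sum-decomposed-leaf Tp V

    sum-decomposed-≤ : ∀ Tp {Td} → IsBST O Td → Balanced Td → ∀ {V} → DisjointSet Tp V →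
                       sum (map (size ∘ decomposed O split Td Tp) V) ≤ size Td
    sum-decomposed-≤ Tp {leaf} _ _ {V} _ = ≤-reflexive (sum-decomposed-leaf Tp V)
    sum-decomposed-≤ leaf {node _ _ _} _ _ {[]}    _            = z≤n
    sum-decomposed-≤ leaf {node _ _ _} _ _ {_ ∷ _} (() ∷ _ , _)
    sum-decomposed-≤ (node L k R) {Td@(node _ _ _)} bst bal {V} V-disjoint@(_ , seps)
      with root-or-nonRoot seps
    ... | inj₁ refl = ≤-reflexive (+-identityʳ (size Td))
    ... | inj₂ nrs with spec Td k bst bal
    ... | bstˡ , balˡ , bstʳ , balʳ , _ = begin
      sum (map f V)
        ≡⟨ sum-descend f nrs ⟩
      sum (map (f ∘ (goL ∷_)) (descend goL V)) + sum (map (f ∘ (goR ∷_)) (descend goR V))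
        ≤⟨ +-mono-≤ (sum-decomposed-≤ L bstˡ balˡ (descend-DisjointSet goL V-disjoint))
                    (sum-decomposed-≤ R bstʳ balʳ (descend-DisjointSet goR V-disjoint)) ⟩
      size (proj₁ (split Td k)) + size (proj₂ (proj₂ (split Td k)))
        ≤⟨ split-size k bst bal ⟩
      size Td
        ∎
      where
      open ≤-Reasoning
      f : Path → ℕ
      f = size ∘ decomposed O split Td (node L k R)

lemma6 : ∀ {a ℓ₁ ℓ₂ β} (O : StrictTotalOrder a ℓ₁ ℓ₂)
           (Balanced : Tree (StrictTotalOrder.Carrier O) → Set β)
           (split : Tree (StrictTotalOrder.Carrier O) → StrictTotalOrder.Carrier O →
                    Tree (StrictTotalOrder.Carrier O) × Bool × Tree (StrictTotalOrder.Carrier O)) →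
           SplitSpec O Balanced split →
           (Td Tp : Tree (StrictTotalOrder.Carrier O)) →
           IsBST O Td → Balanced Td → IsBST O Tp → Balanced Tp →
           (V : List Path) → DisjointSet Tp V →
           sum (map (λ v → size (decomposed O split Td Tp v)) V) ≤ size Td
-- Only the decomposed tree has to satisfy the precondition of split; the
-- pivot tree is merely traversed.
lemma6 O Balanced split spec Td Tp bstd bald _ _ V =
  sum-decomposed-≤ O Balanced split spec Tp bstd bald
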